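{- Let $f(x,y) = f_2 x^2 + f_1 xy + f_0 y^2$ be a binary quadratic form with integer coefficients $f_2, f_1, f_0$ which is primitive and irreducible. Then every integer $h$ that is representable by $f$ is essentially represented by $f$; that is, for every integer $h$ and all $(x,y), (u,v) \in \mathbb{Z}^2$ with $f(x,y) = f(u,v) = h$, there exists $T \in \operatorname{Aut}_{\mathbb{Q}} f$ such that $\binom{x}{y} = T\binom{u}{v}$.
   Context: A binary quadratic form $f(x,y) = f_2 x^2 + f_1 xy + f_0 y^2$ with $f_i \in \mathbb{Z}$ is primitive if $\gcd(f_2,f_1,f_0) = 1$, and irreducible if it is irreducible as a polynomial over $\mathbb{Q}$. An integer $h$ is representable by $f$ if there exist integers $x,y$ with $f(x,y) = h$. The rational automorphism group is $\operatorname{Aut}_{\mathbb{Q}} f = \{ T = \left(\begin{smallmatrix} t_1 & t_2 \\ t_3 & t_4\end{smallmatrix}\right) \in \operatorname{GL}_2(\mathbb{Q}) : f(x,y) = f(t_1 x + t_2 y, t_3 x + t_4 y)\}$. A representable integer $h$ is called essentially represented if whenever $(x,y),(u,v) \in \mathbb{Z}^2$ satisfy $f(x,y) = f(u,v) = h$, there exists $T \in \operatorname{Aut}_{\mathbb{Q}} f$ with $\binom{x}{y} = T\binom{u}{v}$. -}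

module Defs where

open import Data.Integer as ℤ using (ℤ)
open import Data.Integer.GCD as ℤG using ()
open import Data.Rational as ℚ using (ℚ; 0ℚ; 1ℚ)
open import Data.Product using (Σ; _×_; _,_)
open import Relation.Binary.PropositionalEquality using (_≡_)
open import Relation.Nullary using (¬_)

record BQF : Set where
  constructor bqf
  field
    f₂ f₁ f₀ : ℤ
open BQF public

ι : ℤ → ℚ
ι n = n ℚ./ 1

evalℤ : BQF → ℤ → ℤ → ℤ
evalℤ f x y = f₂ f ℤ.* x ℤ.* x ℤ.+ f₁ f ℤ.* x ℤ.* y ℤ.+ f₀ f ℤ.* y ℤ.* y

evalℚ : BQF → ℚ → ℚ → ℚ
evalℚ f x y = ι (f₂ f) ℚ.* x ℚ.* x ℚ.+ ι (f₁ f) ℚ.* x ℚ.* y ℚ.+ ι (f₀ f) ℚ.* y ℚ.* y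

Primitive : BQF → Set
Primitive f = ℤG.gcd (ℤG.gcd (f₂ f) (f₁ f)) (f₀ f) ≡ ℤ.1ℤ

-- irreducible over ℚ: f (a homogeneous quadratic polynomial) is not a product of
-- two linear forms (a x + b y)(c x + d y) with rational coefficients, i.e. there
-- are no a b c d : ℚ with f₂ = a c, f₁ = a d + b c, f₀ = b d (coefficientwise).
Irreducible : BQF → Set
Irreducible f =
  ¬ (Σ ℚ λ a → Σ ℚ λ b → Σ ℚ λ c → Σ ℚ λ d →
       (ι (f₂ f) ≡ a ℚ.* c) × (ι (f₁ f) ≡ a ℚ.* d ℚ.+ b ℚ.* c) × (ι (f₀ f) ≡ b ℚ.* d))

record Mat2 : Set where
  constructor mat
  field
    t₁ t₂ t₃ t₄ : ℚ
open Mat2 public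

det : Mat2 → ℚ
det T = t₁ T ℚ.* t₄ T ℚ.- t₂ T ℚ.* t₃ T

-- T ∈ Aut_ℚ f : T ∈ GL₂(ℚ) and f(x,y) = f(t₁x+t₂y, t₃x+t₄y) as polynomials
-- (stated as an identity for all rational x, y).
InAutℚ : BQF → Mat2 → Set
InAutℚ f T =
  (¬ det T ≡ 0ℚ) ×
  (∀ (x y : ℚ) → evalℚ f x y ≡ evalℚ f (t₁ T ℚ.* x ℚ.+ t₂ T ℚ.* y) (t₃ T ℚ.* x ℚ.+ t₄ T ℚ.* y))

EssentiallyRepresented : BQF → ℤ → Set
EssentiallyRepresented f h =
  ∀ (x y u v : ℤ) → evalℤ f x y ≡ h → evalℤ f u v ≡ h →
    Σ Mat2 λ T → InAutℚ f T ×
      (ι x ≡ t₁ T ℚ.* ι u ℚ.+ t₂ T ℚ.* ι v) × (ι y ≡ t₃ T ℚ.* ι u ℚ.+ t₄ T ℚ.* ι v)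

Representable : BQF → ℤ → Set
Representable f h = Σ ℤ λ x → Σ ℤ λ y → evalℤ f x y ≡ h

-- The automorphism sending (u, v) to (x, y) is the reflection along w = (x, y) − (u, v),
-- p ↦ p − (B(w, p) / f(w)) w with B the polar form of f: it preserves f, and
-- f(x, y) = f(u, v) says exactly that B(w, (u, v)) = −f(w), so it sends (u, v) to (u, v) + w.
-- This needs f(w) ≠ 0, and an irreducible form has no nontrivial rational zero, since a zero
-- (r, 1) or (1, 0) splits off a linear factor; when w = 0 the identity does.
module Submission where

open import Defs
open import Data.Integer as ℤ using (ℤ)
import Data.Integer.Properties as ℤP
open import Data.Empty using (⊥-elim)
open import Level using (0ℓ)
open import Data.Product using (Σ; _×_; _,_; proj₁; proj₂)
open import Data.Rational as ℚ using (ℚ; 0ℚ; 1ℚ; _+_; _*_; _-_; -_)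
open import Data.Rational.Properties
  using ( _≟_; +-*-commutativeRing; +-identityʳ; *-identityˡ; *-zeroˡ; *-zeroʳ; *-inverseˡ
        ; toℚᵘ-injective; toℚᵘ-fromℚᵘ; toℚᵘ-homo-+; toℚᵘ-homo-* )
import Data.Rational.Unnormalised as ℚᵘ
import Data.Rational.Unnormalised.Properties as ℚᵘ
open import Relation.Binary.PropositionalEquality
open import Relation.Nullary using (¬_; yes; no)
open import Relation.Nullary.Decidable.Core using (dec⇒maybe)
open import Tactic.RingSolver using (solve-∀)
open import Tactic.RingSolver.Core.AlmostCommutativeRing using (AlmostCommutativeRing; fromCommutativeRing)

ℚ-ring : AlmostCommutativeRing 0ℓ 0ℓ
ℚ-ring = fromCommutativeRing +-*-commutativeRing (λ x → dec⇒maybe (0ℚ ≟ x))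

toℚᵘ-ι : ∀ n → ℚ.toℚᵘ (ι n) ℚᵘ.≃ ℚᵘ.mkℚᵘ n 0
toℚᵘ-ι n = toℚᵘ-fromℚᵘ (ℚᵘ.mkℚᵘ n 0)

ι-+ : ∀ m n → ι (m ℤ.+ n) ≡ ι m + ι n
ι-+ m n = toℚᵘ-injective (begin
  ℚ.toℚᵘ (ι (m ℤ.+ n))                  ≈⟨ toℚᵘ-ι (m ℤ.+ n) ⟩
  ℚᵘ.mkℚᵘ (m ℤ.+ n) 0                   ≈⟨ ℚᵘ.*≡* (cong (ℤ._* ℤ.1ℤ) (sym (cong₂ ℤ._+_ (ℤP.*-identityʳ m) (ℤP.*-identityʳ n)))) ⟩
  ℚᵘ.mkℚᵘ m 0 ℚᵘ.+ ℚᵘ.mkℚᵘ n 0          ≈⟨ ℚᵘ.+-cong (toℚᵘ-ι m) (toℚᵘ-ι n) ⟨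
  ℚ.toℚᵘ (ι m) ℚᵘ.+ ℚ.toℚᵘ (ι n)        ≈⟨ toℚᵘ-homo-+ (ι m) (ι n) ⟨
  ℚ.toℚᵘ (ι m + ι n)                    ∎)
  where open ℚᵘ.≃-Reasoning

ι-* : ∀ m n → ι (m ℤ.* n) ≡ ι m * ι n
ι-* m n = toℚᵘ-injective (begin
  ℚ.toℚᵘ (ι (m ℤ.* n))                  ≈⟨ toℚᵘ-ι (m ℤ.* n) ⟩
  ℚᵘ.mkℚᵘ m 0 ℚᵘ.* ℚᵘ.mkℚᵘ n 0          ≈⟨ ℚᵘ.*-cong (toℚᵘ-ι m) (toℚᵘ-ι n) ⟨
  ℚ.toℚᵘ (ι m) ℚᵘ.* ℚ.toℚᵘ (ι n)        ≈⟨ toℚᵘ-homo-* (ι m) (ι n) ⟨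
  ℚ.toℚᵘ (ι m * ι n)                    ∎)
  where open ℚᵘ.≃-Reasoning

ι-evalℤ : ∀ f x y → ι (evalℤ f x y) ≡ evalℚ f (ι x) (ι y)
ι-evalℤ (bqf a b c) x y =
  trans (ι-+ (a ℤ.* x ℤ.* x ℤ.+ b ℤ.* x ℤ.* y) (c ℤ.* y ℤ.* y))
    (cong₂ _+_ (trans (ι-+ (a ℤ.* x ℤ.* x) (b ℤ.* x ℤ.* y))
                      (cong₂ _+_ (ι-*³ a x x) (ι-*³ b x y)))
               (ι-*³ c y y))
  where
  ι-*³ : ∀ l m n → ι (l ℤ.* m ℤ.* n) ≡ ι l * ι m * ι n
  ι-*³ l m n = trans (ι-* (l ℤ.* m) n) (cong (_* ι n) (ι-* l m))

p-q≡0⇒p≡q : ∀ {p q} → p - q ≡ 0ℚ → p ≡ q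
p-q≡0⇒p≡q {p} {q} p-q≡0 = begin
  p              ≡⟨ split p q ⟩
  q + (p - q)    ≡⟨ cong (q +_) p-q≡0 ⟩
  q + 0ℚ         ≡⟨ +-identityʳ q ⟩
  q              ∎
  where
  open ≡-Reasoning
  split : ∀ p q → p ≡ q + (p - q)
  split = solve-∀ ℚ-ring

∂₁ ∂₂ : BQF → ℚ → ℚ → ℚ
∂₁ f X Y = (1ℚ + 1ℚ) * ι (f₂ f) * X + ι (f₁ f) * Y
∂₂ f X Y = ι (f₁ f) * X + (1ℚ + 1ℚ) * ι (f₀ f) * Y

polar : BQF → ℚ → ℚ → ℚ → ℚ → ℚ
polar f X Y p q = p * ∂₁ f X Y + q * ∂₂ f X Y

evalℚ-homogeneous : ∀ f t X Y → evalℚ f (t * X) (t * Y) ≡ t * t * evalℚ f X Y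
evalℚ-homogeneous (bqf a b c) = expand (ι a) (ι b) (ι c)
  where
  expand : ∀ a b c t X Y →
    a * (t * X) * (t * X) + b * (t * X) * (t * Y) + c * (t * Y) * (t * Y)
      ≡ t * t * (a * X * X + b * X * Y + c * Y * Y)
  expand = solve-∀ ℚ-ring

evalℚ-+* : ∀ f p q s X Y →
  evalℚ f (p + s * X) (q + s * Y) ≡ evalℚ f p q + s * (polar f X Y p q + s * evalℚ f X Y)
evalℚ-+* (bqf a b c) = expand (ι a) (ι b) (ι c)
  where
  expand : ∀ a b c p q s X Y →
    a * (p + s * X) * (p + s * X) + b * (p + s * X) * (q + s * Y) + c * (q + s * Y) * (q + s * Y)
      ≡ a * p * p + b * p * q + c * q * q
        + s * ((p * ((1ℚ + 1ℚ) * a * X + b * Y) + q * (b * X + (1ℚ + 1ℚ) * c * Y))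
               + s * (a * X * X + b * X * Y + c * Y * Y))
  expand = solve-∀ ℚ-ring

polar-diagonal : ∀ f X Y → polar f X Y X Y ≡ evalℚ f X Y + evalℚ f X Y
polar-diagonal (bqf a b c) = expand (ι a) (ι b) (ι c)
  where
  expand : ∀ a b c X Y →
    X * ((1ℚ + 1ℚ) * a * X + b * Y) + Y * (b * X + (1ℚ + 1ℚ) * c * Y)
      ≡ a * X * X + b * X * Y + c * Y * Y + (a * X * X + b * X * Y + c * Y * Y)
  expand = solve-∀ ℚ-ring

evalℚ-zero-scale : ∀ f {X Y} t → evalℚ f X Y ≡ 0ℚ → evalℚ f (t * X) (t * Y) ≡ 0ℚ
evalℚ-zero-scale f {X} {Y} t f[X,Y]≡0 = begin
  evalℚ f (t * X) (t * Y)   ≡⟨ evalℚ-homogeneous f t X Y ⟩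
  t * t * evalℚ f X Y       ≡⟨ cong (t * t *_) f[X,Y]≡0 ⟩
  t * t * 0ℚ                ≡⟨ *-zeroʳ (t * t) ⟩
  0ℚ                        ∎
  where open ≡-Reasoning

LinearFactorisation : BQF → Set
LinearFactorisation f =
  Σ ℚ λ a → Σ ℚ λ b → Σ ℚ λ c → Σ ℚ λ d →
    (ι (f₂ f) ≡ a * c) × (ι (f₁ f) ≡ a * d + b * c) × (ι (f₀ f) ≡ b * d)

Anisotropic : BQF → Set
Anisotropic f = ∀ X Y → evalℚ f X Y ≡ 0ℚ → X ≡ 0ℚ × Y ≡ 0ℚ

-- f(r, 1) = 0 gives f(x, y) = (x − r y)(a x + (b + r a) y).
root⇒linearFactorisation : ∀ f r → evalℚ f r 1ℚ ≡ 0ℚ → LinearFactorisation f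
root⇒linearFactorisation (bqf a b c) r root =
  1ℚ , - r , ι a , ι b + r * ι a , sym (*-identityˡ (ι a)) , middle (ι a) (ι b) r , last
  where
  open ≡-Reasoning
  middle : ∀ a b r → b ≡ 1ℚ * (b + r * a) + - r * a
  middle = solve-∀ ℚ-ring
  shift : ∀ a b c r → c ≡ - r * (b + r * a) + (a * r * r + b * r * 1ℚ + c * 1ℚ * 1ℚ)
  shift = solve-∀ ℚ-ring
  last : ι c ≡ - r * (ι b + r * ι a)
  last = begin
    ι c                                                    ≡⟨ shift (ι a) (ι b) (ι c) r ⟩
    - r * (ι b + r * ι a) + evalℚ (bqf a b c) r 1ℚ          ≡⟨ cong (- r * (ι b + r * ι a) +_) root ⟩
    - r * (ι b + r * ι a) + 0ℚ                              ≡⟨ +-identityʳ _ ⟩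
    - r * (ι b + r * ι a)                                   ∎

-- f(1, 0) = 0 gives f(x, y) = y (b x + c y).
rootAt∞⇒linearFactorisation : ∀ f → evalℚ f 1ℚ 0ℚ ≡ 0ℚ → LinearFactorisation f
rootAt∞⇒linearFactorisation (bqf a b c) root =
  0ℚ , 1ℚ , ι b , ι c , first , middle (ι b) (ι c) , sym (*-identityˡ (ι c))
  where
  at∞ : ∀ a b c → a ≡ a * 1ℚ * 1ℚ + b * 1ℚ * 0ℚ + c * 0ℚ * 0ℚ
  at∞ = solve-∀ ℚ-ring
  middle : ∀ b c → b ≡ 0ℚ * c + 1ℚ * b
  middle = solve-∀ ℚ-ring
  first : ι a ≡ 0ℚ * ι b
  first = trans (at∞ (ι a) (ι b) (ι c)) (trans root (sym (*-zeroˡ (ι b))))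

irreducible⇒anisotropic : ∀ f → Irreducible f → Anisotropic f
irreducible⇒anisotropic f irr X Y f[X,Y]≡0 with X ≟ 0ℚ | Y ≟ 0ℚ
... | yes X≡0 | yes Y≡0 = X≡0 , Y≡0
... | no X≢0 | yes refl = ⊥-elim (irr (rootAt∞⇒linearFactorisation f root))
  where
  instance _ = ℚ.≢-nonZero X≢0
  root : evalℚ f 1ℚ 0ℚ ≡ 0ℚ
  root = subst₂ (λ s t → evalℚ f s t ≡ 0ℚ) (*-inverseˡ X) (*-zeroʳ (ℚ.1/ X))
                (evalℚ-zero-scale f (ℚ.1/ X) f[X,Y]≡0)
... | _ | no Y≢0 = ⊥-elim (irr (root⇒linearFactorisation f (ℚ.1/ Y * X) root))
  where
  instance _ = ℚ.≢-nonZero Y≢0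
  root : evalℚ f (ℚ.1/ Y * X) 1ℚ ≡ 0ℚ
  root = subst (λ t → evalℚ f (ℚ.1/ Y * X) t ≡ 0ℚ) (*-inverseˡ Y)
               (evalℚ-zero-scale f (ℚ.1/ Y) f[X,Y]≡0)

Sends : Mat2 → ℚ → ℚ → ℚ → ℚ → Set
Sends T u v x y = (x ≡ t₁ T * u + t₂ T * v) × (y ≡ t₃ T * u + t₄ T * v)

I₂ : Mat2
I₂ = mat 1ℚ 0ℚ 0ℚ 1ℚ

I₂-sends : ∀ p q → Sends I₂ p q p q
I₂-sends p q = expand₁ p q , expand₂ p q
  where
  expand₁ : ∀ p q → p ≡ 1ℚ * p + 0ℚ * q
  expand₁ = solve-∀ ℚ-ring
  expand₂ : ∀ p q → q ≡ 0ℚ * p + 1ℚ * q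
  expand₂ = solve-∀ ℚ-ring

I₂-∈Aut : ∀ f → InAutℚ f I₂
I₂-∈Aut f = (λ ()) , λ p q → let x≡ , y≡ = I₂-sends p q in cong₂ (evalℚ f) x≡ y≡

rankOneUpdate : (u₁ u₂ v₁ v₂ : ℚ) → Mat2
rankOneUpdate u₁ u₂ v₁ v₂ = mat (1ℚ + u₁ * v₁) (u₁ * v₂) (u₂ * v₁) (1ℚ + u₂ * v₂)

rankOneUpdate-sends : ∀ u₁ u₂ v₁ v₂ p q →
  Sends (rankOneUpdate u₁ u₂ v₁ v₂) p q (p + (v₁ * p + v₂ * q) * u₁) (q + (v₁ * p + v₂ * q) * u₂)
rankOneUpdate-sends u₁ u₂ v₁ v₂ p q = expand₁ u₁ v₁ v₂ p q , expand₂ u₂ v₁ v₂ p q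
  where
  expand₁ : ∀ u₁ v₁ v₂ p q → p + (v₁ * p + v₂ * q) * u₁ ≡ (1ℚ + u₁ * v₁) * p + u₁ * v₂ * q
  expand₁ = solve-∀ ℚ-ring
  expand₂ : ∀ u₂ v₁ v₂ p q → q + (v₁ * p + v₂ * q) * u₂ ≡ u₂ * v₁ * p + (1ℚ + u₂ * v₂) * q
  expand₂ = solve-∀ ℚ-ring

det-rankOneUpdate : ∀ u₁ u₂ v₁ v₂ → det (rankOneUpdate u₁ u₂ v₁ v₂) ≡ 1ℚ + (v₁ * u₁ + v₂ * u₂)
det-rankOneUpdate = expand
  where
  expand : ∀ u₁ u₂ v₁ v₂ →
    (1ℚ + u₁ * v₁) * (1ℚ + u₂ * v₂) - u₁ * v₂ * (u₂ * v₁) ≡ 1ℚ + (v₁ * u₁ + v₂ * u₂)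
  expand = solve-∀ ℚ-ring

module _ (f : BQF) (X Y : ℚ) .{{_ : ℚ.NonZero (evalℚ f X Y)}} where

  private
    F k : ℚ
    F = evalℚ f X Y
    k = ℚ.1/ F

    k*F≡1 : k * F ≡ 1ℚ
    k*F≡1 = *-inverseˡ F

  -- p ↦ p − (polar f w p / f w) w for w = (X, Y)
  reflection : Mat2
  reflection = rankOneUpdate X Y (- (k * ∂₁ f X Y)) (- (k * ∂₂ f X Y))

  reflection-coefficient : ∀ p q →
    - (k * ∂₁ f X Y) * p + - (k * ∂₂ f X Y) * q ≡ - (k * polar f X Y p q)
  reflection-coefficient = collect k (∂₁ f X Y) (∂₂ f X Y)
    where
    collect : ∀ k d₁ d₂ p q → - (k * d₁) * p + - (k * d₂) * q ≡ - (k * (p * d₁ + q * d₂))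
    collect = solve-∀ ℚ-ring

  reflection-sends : ∀ p q → let s = - (k * polar f X Y p q) in
    Sends reflection p q (p + s * X) (q + s * Y)
  reflection-sends p q =
    subst (λ s → Sends reflection p q (p + s * X) (q + s * Y))
          (reflection-coefficient p q)
          (rankOneUpdate-sends X Y (- (k * ∂₁ f X Y)) (- (k * ∂₂ f X Y)) p q)

  det-reflection : det reflection ≡ - 1ℚ
  det-reflection = begin
    det reflection                            ≡⟨ det-rankOneUpdate X Y (- (k * ∂₁ f X Y)) (- (k * ∂₂ f X Y)) ⟩
    1ℚ + (- (k * ∂₁ f X Y) * X + - (k * ∂₂ f X Y) * Y)
                                              ≡⟨ cong (1ℚ +_) (reflection-coefficient X Y) ⟩
    1ℚ + - (k * polar f X Y X Y)              ≡⟨ cong (λ t → 1ℚ + - (k * t)) (polar-diagonal f X Y) ⟩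
    1ℚ + - (k * (F + F))                      ≡⟨ distribute k F ⟩
    1ℚ - (k * F + k * F)                      ≡⟨ cong (λ t → 1ℚ - (t + t)) k*F≡1 ⟩
    1ℚ - (1ℚ + 1ℚ)                            ≡⟨⟩
    - 1ℚ                                      ∎
    where
    open ≡-Reasoning
    distribute : ∀ k F → 1ℚ + - (k * (F + F)) ≡ 1ℚ - (k * F + k * F)
    distribute = solve-∀ ℚ-ring

  reflection-∈Aut : InAutℚ f reflection
  reflection-∈Aut = (λ det≡0 → -1≢0 (trans (sym det-reflection) det≡0)) , preserves
    where
    open ≡-Reasoning
    -1≢0 : ¬ - 1ℚ ≡ 0ℚ
    -1≢0 ()
    cancel : ∀ B → B + - (k * B) * F ≡ 0ℚ
    cancel B = begin
      B + - (k * B) * F      ≡⟨ factor B k F ⟩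
      B - B * (k * F)        ≡⟨ cong (λ t → B - B * t) k*F≡1 ⟩
      B - B * 1ℚ             ≡⟨ vanish B ⟩
      0ℚ                     ∎
      where
      factor : ∀ B k F → B + - (k * B) * F ≡ B - B * (k * F)
      factor = solve-∀ ℚ-ring
      vanish : ∀ B → B - B * 1ℚ ≡ 0ℚ
      vanish = solve-∀ ℚ-ring
    preserves : ∀ p q → evalℚ f p q ≡ evalℚ f (t₁ reflection * p + t₂ reflection * q)
                                              (t₃ reflection * p + t₄ reflection * q)
    preserves p q = begin
      evalℚ f p q                                   ≡⟨ +-identityʳ (evalℚ f p q) ⟨
      evalℚ f p q + 0ℚ                              ≡⟨ cong (evalℚ f p q +_) (*-zeroʳ s) ⟨
      evalℚ f p q + s * 0ℚ                          ≡⟨ cong (λ t → evalℚ f p q + s * t) (cancel B) ⟨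
      evalℚ f p q + s * (B + s * F)                 ≡⟨ evalℚ-+* f p q s X Y ⟨
      evalℚ f (p + s * X) (q + s * Y)               ≡⟨ cong₂ (evalℚ f) (proj₁ sent) (proj₂ sent) ⟩
      evalℚ f (t₁ reflection * p + t₂ reflection * q) (t₃ reflection * p + t₄ reflection * q) ∎
      where
      B s : ℚ
      B = polar f X Y p q
      s = - (k * B)
      sent : Sends reflection p q (p + s * X) (q + s * Y)
      sent = reflection-sends p q

  reflection-swaps : ∀ u v → evalℚ f (u + X) (v + Y) ≡ evalℚ f u v →
    Sends reflection u v (u + X) (v + Y)
  reflection-swaps u v same =
    subst₂ (λ a b → Sends reflection u v (u + a) (v + b))
           (trans (cong (_* X) coefficient≡1) (*-identityˡ X))
           (trans (cong (_* Y) coefficient≡1) (*-identityˡ Y))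
           (reflection-sends u v)
    where
    open ≡-Reasoning
    G B : ℚ
    G = evalℚ f u v
    B = polar f X Y u v
    -- f(u + X, v + Y) = f(u, v) forces polar f w (u, v) = − f w.
    level : G + 1ℚ * (B + 1ℚ * F) ≡ G
    level = begin
      G + 1ℚ * (B + 1ℚ * F)              ≡⟨ evalℚ-+* f u v 1ℚ X Y ⟨
      evalℚ f (u + 1ℚ * X) (v + 1ℚ * Y)  ≡⟨ cong₂ (λ s t → evalℚ f (u + s) (v + t)) (*-identityˡ X) (*-identityˡ Y) ⟩
      evalℚ f (u + X) (v + Y)            ≡⟨ same ⟩
      G                                  ∎
    coefficient≡1 : - (k * B) ≡ 1ℚ
    coefficient≡1 = begin
      - (k * B)                                  ≡⟨ regroup k B F G ⟩
      k * F - k * ((G + 1ℚ * (B + 1ℚ * F)) - G)  ≡⟨ cong₂ (λ s t → s - k * (t - G)) k*F≡1 level ⟩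
      1ℚ - k * (G - G)                           ≡⟨ vanish k G ⟩
      1ℚ                                         ∎
      where
      regroup : ∀ k B F G → - (k * B) ≡ k * F - k * ((G + 1ℚ * (B + 1ℚ * F)) - G)
      regroup = solve-∀ ℚ-ring
      vanish : ∀ k G → 1ℚ - k * (G - G) ≡ 1ℚ
      vanish = solve-∀ ℚ-ring

anisotropic⇒Aut-transitive : ∀ f → Anisotropic f → ∀ x y u v → evalℚ f x y ≡ evalℚ f u v →
  Σ Mat2 λ T → InAutℚ f T × Sends T u v x y
anisotropic⇒Aut-transitive f aniso x y u v same with evalℚ f (x - u) (y - v) ≟ 0ℚ
... | yes f[w]≡0 =
  let x-u≡0 , y-v≡0 = aniso (x - u) (y - v) f[w]≡0 in
  I₂ , I₂-∈Aut f ,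
  subst₂ (Sends I₂ u v) (sym (p-q≡0⇒p≡q x-u≡0)) (sym (p-q≡0⇒p≡q y-v≡0)) (I₂-sends u v)
... | no f[w]≢0 =
  reflection f X Y , reflection-∈Aut f X Y ,
  subst₂ (Sends (reflection f X Y) u v) (u+[x-u]≡x u x) (u+[x-u]≡x v y)
         (reflection-swaps f X Y u v (subst₂ (λ s t → evalℚ f s t ≡ evalℚ f u v)
                                             (sym (u+[x-u]≡x u x)) (sym (u+[x-u]≡x v y)) same))
  where
  instance _ = ℚ.≢-nonZero f[w]≢0
  X Y : ℚ
  X = x - u
  Y = y - v
  u+[x-u]≡x : ∀ u x → u + (x - u) ≡ x
  u+[x-u]≡x = solve-∀ ℚ-ring

theorem1p1 : (f : BQF) → Primitive f → Irreducible f →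
    (h : ℤ) → Representable f h → EssentiallyRepresented f h
theorem1p1 f _ irr _ _ x y u v f[x,y]≡h f[u,v]≡h =
  anisotropic⇒Aut-transitive f (irreducible⇒anisotropic f irr) (ι x) (ι y) (ι u) (ι v) same
  where
  open ≡-Reasoning
  same : evalℚ f (ι x) (ι y) ≡ evalℚ f (ι u) (ι v)
  same = begin
    evalℚ f (ι x) (ι y)   ≡⟨ ι-evalℤ f x y ⟨
    ι (evalℤ f x y)       ≡⟨ cong ι (trans f[x,y]≡h (sym f[u,v]≡h)) ⟩
    ι (evalℤ f u v)       ≡⟨ ι-evalℤ f u v ⟩
    evalℚ f (ι u) (ι v)   ∎
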